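{- Let $\mathcal T$ be an extensional typed combinatory algebra. The functor $E:\mathcal{T}\to\mathbf{Asm}_{\mathcal{T}}$ is full and faithful. Moreover, every assembly in the image of $E$ is basic, and every basic assembly is isomorphic to an assembly in the image of $E$.
   Context: A typed combinatory algebra (tca) $\mathcal{T}$ consists of a set of types containing $\bot,\top,N$ and closed under $\times,\to,+$; sets $|T|$; total application maps $|S\to T|\times|S|\to|T|$, $(a,b)\mapsto ab$; and elements $\mathsf{exf},\mathsf t,\mathsf k,\mathsf s,\mathsf{pair},\mathsf{fst},\mathsf{snd},\mathsf{inl},\mathsf{inr},\mathsf{case},\mathsf 0,\mathsf{succ},\mathsf R$ of the appropriate types satisfying $\mathsf{k}ab=a$, $\mathsf{s}abc=ac(bc)$, $\mathsf{fst}(\mathsf{pair}ab)=a$, $\mathsf{snd}(\mathsf{pair}ab)=b$, $\mathsf{case}ab(\mathsf{inl}x)=ax$, $\mathsf{case}ab(\mathsf{inr}x)=bx$, $\mathsf{R}ab\mathsf{0}=a$, $\mathsf{R}ab(\mathsf{succ}n)=bn(\mathsf{R}abn)$. $\mathcal T$ is extensional if the maps $|S\times T|\to|S|\times|T|$, $x\mapsto(\mathsf{fst}x,\mathsf{snd}x)$ and $|T\to S|\to|S|^{|T|}$, $x\mapsto(y\mapsto xy)$ are injective and $|\top|=\{\mathsf t\}$. For extensional $\mathcal T$, the category also denoted $\mathcal T$ has the types as objects and elements of $|A\to B|$ as morphisms $A\to B$, with identity $\lambda x.x$ and composition $\lambda x.g(fx)$. An assembly over $\mathcal{T}$ is $(X,A,\alpha)$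 with $X$ a set, $A$ a type, $\alpha(x)\subseteq|A|$ inhabited; a morphism $(X,A,\alpha)\to(Y,B,\beta)$ is a function $f:X\to Y$ with some $e\in|A\to B|$ such that $a\in\alpha(x)\Rightarrow ea\in\beta(f(x))$; this gives $\mathbf{Asm}_{\mathcal{T}}$. The functor $E$ sends $A$ to $(|A|,A,x\mapsto\{x\})$ and a morphism $f$ to the function $x\mapsto fx$. An assembly is modest if $a\in\alpha(x)\cap\alpha(y)$ implies $x=y$; strongly modest if moreover each $\alpha(x)$ is a singleton; exhaustive if every $a\in|A|$ lies in some $\alpha(x)$; basic if strongly modest and exhaustive. -}

module Defs where

open import Data.Product using (Σ; ∃; _×_; _,_)
open import Relation.Binary.PropositionalEquality using (_≡_; refl; cong)

record TCA : Set₁ where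
  infixr 5 _⇒_
  infixr 7 _⊗_
  infixr 6 _⊕_
  infixl 9 _·_
  field
    Ty   : Set
    ⊥ᵀ   : Ty
    ⊤ᵀ   : Ty
    Nᵀ   : Ty
    _⊗_  : Ty → Ty → Ty
    _⇒_  : Ty → Ty → Ty
    _⊕_  : Ty → Ty → Ty
    ∣_∣  : Ty → Set
    _·_  : ∀ {S T} → ∣ S ⇒ T ∣ → ∣ S ∣ → ∣ T ∣
    exf  : ∀ {T} → ∣ ⊥ᵀ ⇒ T ∣
    t    : ∣ ⊤ᵀ ∣
    k    : ∀ {S T} → ∣ S ⇒ T ⇒ S ∣
    s    : ∀ {R S T} → ∣ (R ⇒ S ⇒ T) ⇒ (R ⇒ S) ⇒ R ⇒ T ∣
    pair : ∀ {S T} → ∣ S ⇒ T ⇒ S ⊗ T ∣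
    fst  : ∀ {S T} → ∣ S ⊗ T ⇒ S ∣
    snd  : ∀ {S T} → ∣ S ⊗ T ⇒ T ∣
    inl  : ∀ {S T} → ∣ S ⇒ S ⊕ T ∣
    inr  : ∀ {S T} → ∣ T ⇒ S ⊕ T ∣
    case : ∀ {S T R} → ∣ (S ⇒ R) ⇒ (T ⇒ R) ⇒ S ⊕ T ⇒ R ∣
    zer  : ∣ Nᵀ ∣
    succ : ∣ Nᵀ ⇒ Nᵀ ∣
    rec  : ∀ {T} → ∣ T ⇒ (Nᵀ ⇒ T ⇒ T) ⇒ Nᵀ ⇒ T ∣
    k-eq    : ∀ {S T} (a : ∣ S ∣) (b : ∣ T ∣) → k · a · b ≡ a
    s-eq    : ∀ {R S T} (a : ∣ R ⇒ S ⇒ T ∣) (b : ∣ R ⇒ S ∣) (c : ∣ R ∣) →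
              s · a · b · c ≡ a · c · (b · c)
    fst-eq  : ∀ {S T} (a : ∣ S ∣) (b : ∣ T ∣) → fst · (pair · a · b) ≡ a
    snd-eq  : ∀ {S T} (a : ∣ S ∣) (b : ∣ T ∣) → snd · (pair · a · b) ≡ b
    inl-eq  : ∀ {S T R} (a : ∣ S ⇒ R ∣) (b : ∣ T ⇒ R ∣) (x : ∣ S ∣) →
              case · a · b · (inl · x) ≡ a · x
    inr-eq  : ∀ {S T R} (a : ∣ S ⇒ R ∣) (b : ∣ T ⇒ R ∣) (x : ∣ T ∣) →
              case · a · b · (inr · x) ≡ b · x
    rec-0   : ∀ {T} (a : ∣ T ∣) (b : ∣ Nᵀ ⇒ T ⇒ T ∣) → rec · a · b · zer ≡ a
    rec-suc : ∀ {T} (a : ∣ T ∣) (b : ∣ Nᵀ ⇒ T ⇒ T ∣) (n : ∣ Nᵀ ∣) →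
              rec · a · b · (succ · n) ≡ b · n · (rec · a · b · n)

module _ (𝒯 : TCA) where
  open TCA 𝒯

  record Extensional : Set where
    field
      pair-inj : ∀ {S T} (x y : ∣ S ⊗ T ∣) →
                 fst · x ≡ fst · y → snd · x ≡ snd · y → x ≡ y
      app-inj  : ∀ {S T} (x y : ∣ T ⇒ S ∣) → (∀ z → x · z ≡ y · z) → x ≡ y
      ⊤-single : ∀ (x : ∣ ⊤ᵀ ∣) → x ≡ t

  -- Assemblies (X, A, α); subsets of |A| are predicates.
  record Asm : Set₁ where
    field
      X     : Set
      A     : Ty
      α     : X → ∣ A ∣ → Set
      α-inh : ∀ x → Σ ∣ A ∣ (λ a → α x a)

  record AsmHom (𝑋 𝑌 : Asm) : Set where
    open Asm
    field
      fun     : X 𝑋 → X 𝑌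
      tracked : Σ ∣ A 𝑋 ⇒ A 𝑌 ∣ λ e →
                  ∀ x a → α 𝑋 x a → α 𝑌 (fun x) (e · a)
  open AsmHom public

  _≈ₕ_ : ∀ {𝑋 𝑌} → AsmHom 𝑋 𝑌 → AsmHom 𝑋 𝑌 → Set
  f ≈ₕ g = ∀ x → fun f x ≡ fun g x

  idₕ : ∀ {𝑋} → AsmHom 𝑋 𝑋
  idₕ {𝑋} = record { fun = λ x → x
                    ; tracked = (s · k · k {T = Asm.A 𝑋}) , λ x a p →
                        Relation.Binary.PropositionalEquality.subst (Asm.α 𝑋 x)
                          (Relation.Binary.PropositionalEquality.sym
                            (Relation.Binary.PropositionalEquality.trans
                              (s-eq k (k {T = Asm.A 𝑋}) a) (k-eq a (k {T = Asm.A 𝑋} · a)))) p }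

  _∘ₕ_ : ∀ {𝑋 𝑌 𝑍} → AsmHom 𝑌 𝑍 → AsmHom 𝑋 𝑌 → AsmHom 𝑋 𝑍
  _∘ₕ_ {𝑋} {𝑌} {𝑍} g f = record
    { fun = λ x → fun g (fun f x)
    ; tracked = (s · (k · eg) · ef) , λ x a p →
        Relation.Binary.PropositionalEquality.subst (Asm.α 𝑍 (fun g (fun f x)))
          (Relation.Binary.PropositionalEquality.sym
            (Relation.Binary.PropositionalEquality.trans (s-eq (k · eg) ef a)
              (cong (λ u → u · (ef · a)) (k-eq eg a))))
          (rg (fun f x) (ef · a) (rf x a p)) }
    where
    eg = Data.Product.proj₁ (tracked g)
    rg = Data.Product.proj₂ (tracked g)
    ef = Data.Product.proj₁ (tracked f)
    rf = Data.Product.proj₂ (tracked f)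

  record _≅_ (𝑋 𝑌 : Asm) : Set where
    field
      to      : AsmHom 𝑋 𝑌
      from    : AsmHom 𝑌 𝑋
      from∘to : (from ∘ₕ to) ≈ₕ idₕ
      to∘from : (to ∘ₕ from) ≈ₕ idₕ

  Modest : Asm → Set
  Modest 𝑋 = ∀ x y a → α x a → α y a → x ≡ y
    where open Asm 𝑋

  StronglyModest : Asm → Set
  StronglyModest 𝑋 = Modest 𝑋 ×
    (∀ x → Σ ∣ A ∣ λ a → α x a × (∀ b → α x b → b ≡ a))
    where open Asm 𝑋

  Exhaustive : Asm → Set
  Exhaustive 𝑋 = ∀ (a : ∣ A ∣) → Σ X λ x → α x a
    where open Asm 𝑋

  Basic : Asm → Set
  Basic 𝑋 = StronglyModest 𝑋 × Exhaustive 𝑋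

  Hom : Ty → Ty → Set
  Hom A B = ∣ A ⇒ B ∣

  E₀ : Ty → Asm
  E₀ A = record { X = ∣ A ∣ ; A = A ; α = λ x a → a ≡ x ; α-inh = λ x → x , refl }

  E₁ : ∀ {A B} → Hom A B → AsmHom (E₀ A) (E₀ B)
  E₁ f = record { fun = λ x → f · x ; tracked = f , λ x a p → cong (f ·_) p }

  Full : Set
  Full = ∀ {A B} (h : AsmHom (E₀ A) (E₀ B)) → Σ (Hom A B) λ f → E₁ f ≈ₕ h

  Faithful : Set
  Faithful = ∀ {A B} (f g : Hom A B) → E₁ f ≈ₕ E₁ g → f ≡ g

{-# OPTIONS --safe #-}
module Submission where

-- In E₀ A every element is realized exactly by itself, so a tracker of a
-- morphism E₀ A → E₀ B computes that morphism (fullness), and faithfulness is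
-- extensionality of application. In a basic assembly the realizability
-- relation is the graph of a bijection X ≃ |A|; both directions are tracked
-- by the identity combinator s k k, giving the isomorphism with E₀ A.

open import Defs
open import Data.Product using (Σ; _×_; _,_; proj₁; proj₂)
open import Relation.Binary.PropositionalEquality using (_≡_; refl; sym; trans; subst)

module _ (𝒯 : TCA) where
  open TCA 𝒯

  I : ∀ {A} → ∣ A ⇒ A ∣
  I {A} = s · k · k {T = A}

  I-eq : ∀ {A} (a : ∣ A ∣) → I · a ≡ a
  I-eq {A} a = trans (s-eq k (k {T = A}) a) (k-eq a (k {T = A} · a))

  E-full : Full 𝒯
  E-full h = proj₁ (tracked h) , λ x → proj₂ (tracked h) x x refl

  E-faithful : Extensional 𝒯 → Faithful 𝒯
  E-faithful ext = Extensional.app-inj ext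

  E₀-stronglyModest : ∀ A → StronglyModest 𝒯 (E₀ 𝒯 A)
  E₀-stronglyModest A = (λ x y a a≡x a≡y → trans (sym a≡x) a≡y)
                      , λ x → x , refl , λ b b≡x → b≡x

  E₀-exhaustive : ∀ A → Exhaustive 𝒯 (E₀ 𝒯 A)
  E₀-exhaustive A a = a , refl

  E₀-basic : ∀ A → Basic 𝒯 (E₀ 𝒯 A)
  E₀-basic A = E₀-stronglyModest A , E₀-exhaustive A

  basic≅E₀ : (𝑋 : Asm 𝒯) → Basic 𝒯 𝑋 → _≅_ 𝒯 𝑋 (E₀ 𝒯 (Asm.A 𝑋))
  basic≅E₀ 𝑋 ((modest , unique) , exhaustive) = record
    { to      = record { fun = realizer ; tracked = I , to-tracked }
    ; from    = record { fun = point ; tracked = I , from-tracked }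
    ; from∘to = λ x → modest (point (realizer x)) x (realizer x)
                        (point-realized (realizer x)) (realizer-realizes x)
    ; to∘from = λ a → sym (realizer-unique (point a) a (point-realized a))
    }
    where
    open Asm 𝑋

    realizer : X → ∣ A ∣
    realizer x = proj₁ (unique x)

    realizer-realizes : ∀ x → α x (realizer x)
    realizer-realizes x = proj₁ (proj₂ (unique x))

    realizer-unique : ∀ x a → α x a → a ≡ realizer x
    realizer-unique x = proj₂ (proj₂ (unique x))

    point : ∣ A ∣ → X
    point a = proj₁ (exhaustive a)

    point-realized : ∀ a → α (point a) a
    point-realized a = proj₂ (exhaustive a)

    to-tracked : ∀ x a → α x a → I · a ≡ realizer x
    to-tracked x a αxa = trans (I-eq a) (realizer-unique x a αxa)

    from-tracked : ∀ b a → a ≡ b → α (point b) (I · a)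
    from-tracked b a a≡b = subst (α (point b)) (sym (trans (I-eq a) a≡b)) (point-realized b)

mainTheorem12 : (𝒯 : TCA) → Extensional 𝒯 →
    Full 𝒯 × Faithful 𝒯 ×
    (∀ A → Basic 𝒯 (E₀ 𝒯 A)) ×
    (∀ (𝑋 : Asm 𝒯) → Basic 𝒯 𝑋 → Σ (TCA.Ty 𝒯) λ A → _≅_ 𝒯 𝑋 (E₀ 𝒯 A))
mainTheorem12 𝒯 ext =
  E-full 𝒯 , E-faithful 𝒯 ext , E₀-basic 𝒯 ,
  λ 𝑋 basic → Asm.A 𝑋 , basic≅E₀ 𝒯 𝑋 basic
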